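{- Let $u,v$ be coprime integers with $u$ odd and positive and $n=u^2-2v^2>0$. Let $f\in\{1,4\}$, $\tau=f\sqrt{ -2n}$, and consider the order $\mathbb{Z}[\tau]$. Let $\mathfrak{u}=(u,\,2vf-\tau)$ be the ideal of $\mathbb{Z}[\tau]$ generated by $u$ and $2vf-\tau$ (the kernel of the ring map $\mathbb{Z}[\tau]\to\mathbb{Z}/u\mathbb{Z}$ sending $\tau\mapsto 2vf$), and let $\mathfrak{p}_f=(2vf-\tau,\,2f^2)$ (the kernel of the ring map $\mathbb{Z}[\tau]\to\mathbb{Z}/2f^2\mathbb{Z}$ sending $\tau\mapsto 2vf$). Then, as ideals of $\mathbb{Z}[\tau]$, $$(2vf-\tau)=\mathfrak{p}_f\,\mathfrak{u}^2.$$ -}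

module Defs where

open import Data.Integer using (ℤ; _+_; _*_; -_; _-_; +_; 0ℤ)
open import Data.Product using (_×_; _,_; ∃; Σ-syntax; ∃-syntax)
open import Data.List using (List; []; _∷_)
open import Data.List.Relation.Unary.All using (All)
open import Relation.Binary.PropositionalEquality using (_≡_)

-- The order ℤ[τ] where τ² = D, with elements a + b·τ represented by (a , b).
module Order (D : ℤ) where

  record Elt : Set where
    constructor _+_τ
    field
      re : ℤ
      im : ℤ
  open Elt public

  ι : ℤ → Elt
  ι a = a + 0ℤ τ

  τ′ : Elt
  τ′ = 0ℤ + (+ 1) τ

  0e : Elt
  0e = ι 0ℤ

  _⊕_ : Elt → Elt → Elt
  (a + b τ) ⊕ (c + d τ) = (a + c) + (b + d) τ

  _⊖_ : Elt → Elt → Elt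
  (a + b τ) ⊖ (c + d τ) = (a - c) + (b - d) τ

  -- (a + bτ)(c + dτ) = (ac + bdD) + (ad + bc)τ  since τ² = D
  _⊛_ : Elt → Elt → Elt
  (a + b τ) ⊛ (c + d τ) = (a * c + b * d * D) + (a * d + b * c) τ

  Subset : Set₁
  Subset = Elt → Set

  ⟨_⟩ : List Elt → Subset
  ⟨ [] ⟩ x = x ≡ 0e
  ⟨ g ∷ gs ⟩ x = ∃[ r ] ∃[ y ] (⟨ gs ⟩ y × x ≡ (r ⊛ g) ⊕ y)

  sumProd : List (Elt × Elt) → Elt
  sumProd [] = 0e
  sumProd ((a , b) ∷ ps) = (a ⊛ b) ⊕ sumProd ps

  _⊗_ : Subset → Subset → Subset
  (I ⊗ J) x = ∃[ ps ] (All (λ p → I (Data.Product.proj₁ p) × J (Data.Product.proj₂ p)) ps × x ≡ sumProd ps)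

  _≐_ : Subset → Subset → Set
  I ≐ J = ∀ x → (I x → J x) × (J x → I x)

-- Write g = 2vf − τ and ḡ = 2vf + τ for its conjugate, c = 2f², w = 4vf.
-- Two facts about g drive the proof:  g·ḡ = c·u²  (norm) and  g + ḡ = w  (trace).
--
-- (⊇)  𝔲² ⊆ (u², g), since every product of generators of 𝔲 lies in (u², g); and
--      every product of a generator of 𝔭 = (g, c) with one of (u², g) is a multiple
--      of g, the only non-obvious case being c·u² = ḡ·g.  Hence 𝔭𝔲² ⊆ (g).
-- (⊆)  u² and w² are coprime (u is odd and prime to v), so a·u² + b·w² = 1 over ℤ,
--      and then  g = (a g + b(2g + ḡ)c)·u² + (b g)·g²,  which lies in 𝔭𝔲².
module Submission where

open import Defs
open import Algebra.Bundles using (CommutativeRing)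
open import Algebra.Structures using (IsCommutativeRing)
open import Algebra.Consequences.Propositional
  using (comm∧idˡ⇒idʳ; comm∧invˡ⇒invʳ; comm∧distrˡ⇒distrʳ)
open import Data.Empty using (⊥-elim)
open import Data.Integer using (ℤ; _+_; _*_; -_; _-_; +_; -[1+_]; _>_; ∣_∣; 0ℤ; 1ℤ)
import Data.Integer.Properties as ℤ
open import Data.Integer.Divisibility using () renaming (_∣_ to _∣ℤ_)
open import Data.Integer.Tactic.RingSolver using (solve-∀)
open import Data.List using (_∷_; []; _++_)
open import Data.List.Membership.Propositional using (_∈_)
open import Data.List.Relation.Unary.All using ([]; _∷_)
open import Data.List.Relation.Unary.All.Properties using (++⁺)
open import Data.List.Relation.Unary.Any using (here; there)
open import Data.Maybe using (nothing)
import Data.Nat as ℕ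
open import Data.Nat.Coprimality using (Coprime; coprime-Bézout)
open import Data.Nat.Divisibility using () renaming (_∣_ to _∣ℕ_)
open import Data.Nat.GCD using (module Bézout)
open import Data.Nat.Primality using (irreducible[2])
open import Data.Product using (_,_; ∃₂)
open import Data.Sum using (_⊎_; inj₁; inj₂)
open import Relation.Binary.PropositionalEquality
  using (_≡_; refl; sym; trans; cong; cong₂; subst; isEquivalence; module ≡-Reasoning)
open import Relation.Nullary using (¬_)
import Tactic.RingSolver.Core.AlmostCommutativeRing as ACR

⊛-comm-re : ∀ a b c d D → a * c + b * d * D ≡ c * a + d * b * D
⊛-comm-re = solve-∀

⊛-comm-im : ∀ a b c d → a * d + b * c ≡ c * b + d * a
⊛-comm-im = solve-∀

⊛-identityˡ-re : ∀ a b D → 1ℤ * a + 0ℤ * b * D ≡ a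
⊛-identityˡ-re = solve-∀

⊛-identityˡ-im : ∀ a b → 1ℤ * b + 0ℤ * a ≡ b
⊛-identityˡ-im = solve-∀

⊛-assoc-re : ∀ a b c d e f D → (a * c + b * d * D) * e + (a * d + b * c) * f * D
                              ≡ a * (c * e + d * f * D) + b * (c * f + d * e) * D
⊛-assoc-re = solve-∀

⊛-assoc-im : ∀ a b c d e f D → (a * c + b * d * D) * f + (a * d + b * c) * e
                              ≡ a * (c * f + d * e) + b * (c * e + d * f * D)
⊛-assoc-im = solve-∀

⊛-distribˡ-re : ∀ a b c d e f D → a * (c + e) + b * (d + f) * D ≡ (a * c + b * d * D) + (a * e + b * f * D)
⊛-distribˡ-re = solve-∀

⊛-distribˡ-im : ∀ a b c d e f → a * (d + f) + b * (c + e) ≡ (a * d + b * c) + (a * f + b * e)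
⊛-distribˡ-im = solve-∀

norm-re : ∀ a b D → a * a + b * (- b) * D ≡ a * a - b * b * D
norm-re = solve-∀

norm-im : ∀ a b → a * (- b) + b * a ≡ 0ℤ
norm-im = solve-∀

ι-⊛-re : ∀ a b D → a * b ≡ a * b + 0ℤ * 0ℤ * D
ι-⊛-re = solve-∀

ι-⊛-im : ∀ a b → 0ℤ ≡ a * 0ℤ + 0ℤ * b
ι-⊛-im = solve-∀

module QuadraticOrder (D : ℤ) where
  open Order D public

  elt≡ : ∀ {a b c d} → a ≡ c → b ≡ d → a + b τ ≡ c + d τ
  elt≡ = cong₂ _+_τ

  ⊝_ : Elt → Elt
  ⊝ (a + b τ) = (- a) + (- b) τ

  1e : Elt
  1e = ι 1ℤ

  ⊕-assoc : ∀ x y z → (x ⊕ y) ⊕ z ≡ x ⊕ (y ⊕ z)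
  ⊕-assoc (a + b τ) (c + d τ) (e + f τ) = elt≡ (ℤ.+-assoc a c e) (ℤ.+-assoc b d f)

  ⊕-comm : ∀ x y → x ⊕ y ≡ y ⊕ x
  ⊕-comm (a + b τ) (c + d τ) = elt≡ (ℤ.+-comm a c) (ℤ.+-comm b d)

  ⊕-identityˡ : ∀ x → 0e ⊕ x ≡ x
  ⊕-identityˡ (a + b τ) = elt≡ (ℤ.+-identityˡ a) (ℤ.+-identityˡ b)

  ⊝-inverseˡ : ∀ x → (⊝ x) ⊕ x ≡ 0e
  ⊝-inverseˡ (a + b τ) = elt≡ (ℤ.+-inverseˡ a) (ℤ.+-inverseˡ b)

  ⊛-comm : ∀ x y → x ⊛ y ≡ y ⊛ x
  ⊛-comm (a + b τ) (c + d τ) = elt≡ (⊛-comm-re a b c d D) (⊛-comm-im a b c d)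

  ⊛-identityˡ : ∀ x → 1e ⊛ x ≡ x
  ⊛-identityˡ (a + b τ) = elt≡ (⊛-identityˡ-re a b D) (⊛-identityˡ-im a b)

  ⊛-assoc : ∀ x y z → (x ⊛ y) ⊛ z ≡ x ⊛ (y ⊛ z)
  ⊛-assoc (a + b τ) (c + d τ) (e + f τ) = elt≡ (⊛-assoc-re a b c d e f D) (⊛-assoc-im a b c d e f D)

  ⊛-distribˡ : ∀ x y z → x ⊛ (y ⊕ z) ≡ (x ⊛ y) ⊕ (x ⊛ z)
  ⊛-distribˡ (a + b τ) (c + d τ) (e + f τ) = elt≡ (⊛-distribˡ-re a b c d e f D) (⊛-distribˡ-im a b c d e f)

  isCommutativeRing : IsCommutativeRing _≡_ _⊕_ _⊛_ ⊝_ 0e 1e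
  isCommutativeRing = record
    { isRing = record
      { +-isAbelianGroup = record
        { isGroup = record
          { isMonoid = record
            { isSemigroup = record
              { isMagma = record { isEquivalence = isEquivalence ; ∙-cong = cong₂ _⊕_ }
              ; assoc = ⊕-assoc }
            ; identity = ⊕-identityˡ , comm∧idˡ⇒idʳ ⊕-comm ⊕-identityˡ }
          ; inverse = ⊝-inverseˡ , comm∧invˡ⇒invʳ ⊕-comm ⊝-inverseˡ
          ; ⁻¹-cong = cong ⊝_ }
        ; comm = ⊕-comm }
      ; *-cong = cong₂ _⊛_
      ; *-assoc = ⊛-assoc
      ; *-identity = ⊛-identityˡ , comm∧idˡ⇒idʳ ⊛-comm ⊛-identityˡ
      ; distrib = ⊛-distribˡ , comm∧distrˡ⇒distrʳ ⊛-comm ⊛-distribˡ }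
    ; *-comm = ⊛-comm }

  commutativeRing : CommutativeRing _ _
  commutativeRing = record { isCommutativeRing = isCommutativeRing }

  almostCommutativeRing : ACR.AlmostCommutativeRing _ _
  almostCommutativeRing = ACR.fromCommutativeRing commutativeRing (λ _ → nothing)

  open CommutativeRing commutativeRing public
    using (distribʳ; zeroˡ; zeroʳ; +-identityʳ; *-identityʳ; +-commutativeSemigroup)
  open import Algebra.Properties.CommutativeSemigroup +-commutativeSemigroup using (interchange)

  record IsIdeal (I : Subset) : Set where
    field
      0∈ : I 0e
      ⊕∈ : ∀ {x y} → I x → I y → I (x ⊕ y)
      ⊛∈ : ∀ r {x} → I x → I (r ⊛ x)

    ⊛∈ʳ : ∀ {x} r → I x → I (x ⊛ r)
    ⊛∈ʳ {x} r x∈ = subst I (⊛-comm r x) (⊛∈ r x∈)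

  open IsIdeal public

  _⊆_ : Subset → Subset → Set
  I ⊆ J = ∀ {x} → I x → J x

  ⟨⟩-isIdeal : ∀ gs → IsIdeal ⟨ gs ⟩
  ⟨⟩-isIdeal [] = record
    { 0∈ = refl
    ; ⊕∈ = λ { refl refl → +-identityʳ 0e }
    ; ⊛∈ = λ { r refl → zeroʳ r } }
  ⟨⟩-isIdeal (g ∷ gs) = record
    { 0∈ = 0e , 0e , 0∈ (⟨⟩-isIdeal gs) , sym (trans (+-identityʳ (0e ⊛ g)) (zeroˡ g))
    ; ⊕∈ = λ { (r , y , y∈ , refl) (s , z , z∈ , refl) →
               r ⊕ s , y ⊕ z , ⊕∈ (⟨⟩-isIdeal gs) y∈ z∈ , ⊕-interchange r s y z }
    ; ⊛∈ = λ { t (r , y , y∈ , refl) →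
               t ⊛ r , t ⊛ y , ⊛∈ (⟨⟩-isIdeal gs) t y∈ ,
               trans (⊛-distribˡ t (r ⊛ g) y) (cong (_⊕ (t ⊛ y)) (sym (⊛-assoc t r g))) } }
    where
    ⊕-interchange : ∀ r s y z → ((r ⊛ g) ⊕ y) ⊕ ((s ⊛ g) ⊕ z) ≡ ((r ⊕ s) ⊛ g) ⊕ (y ⊕ z)
    ⊕-interchange r s y z = trans (interchange (r ⊛ g) y (s ⊛ g) z)
                                  (cong (_⊕ (y ⊕ z)) (sym (distribʳ g r s)))

  ∈⟨⟩ : ∀ {g gs} → g ∈ gs → ⟨ gs ⟩ g
  ∈⟨⟩ {g} {_ ∷ gs} (here refl) = 1e , 0e , 0∈ (⟨⟩-isIdeal gs) , sym (trans (+-identityʳ _) (⊛-identityˡ g))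
  ∈⟨⟩ {g} {h ∷ _}  (there g∈)  = 0e , g , ∈⟨⟩ g∈ , sym (trans (cong (_⊕ g) (zeroˡ h)) (⊕-identityˡ g))

  ⟨⟩-least : ∀ {I gs} → IsIdeal I → (∀ {g} → g ∈ gs → I g) → ⟨ gs ⟩ ⊆ I
  ⟨⟩-least {gs = []}     I-ideal gs⊆I refl = 0∈ I-ideal
  ⟨⟩-least {gs = g ∷ gs} I-ideal gs⊆I (r , y , y∈ , refl) =
    ⊕∈ I-ideal (⊛∈ I-ideal r (gs⊆I (here refl))) (⟨⟩-least I-ideal (λ g∈ → gs⊆I (there g∈)) y∈)

  ⊛-preimage : ∀ {K} → IsIdeal K → ∀ y → IsIdeal (λ x → K (x ⊛ y))
  ⊛-preimage {K} K-ideal y = record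
    { 0∈ = subst K (sym (zeroˡ y)) (0∈ K-ideal)
    ; ⊕∈ = λ {x} {x′} p q → subst K (sym (distribʳ y x x′)) (⊕∈ K-ideal p q)
    ; ⊛∈ = λ r {x} p → subst K (sym (⊛-assoc r x y)) (⊛∈ K-ideal r p) }

  ⟨⟩-⊛-closed : ∀ {K as bs} → IsIdeal K → (∀ {a b} → a ∈ as → b ∈ bs → K (a ⊛ b)) →
                ∀ {x y} → ⟨ as ⟩ x → ⟨ bs ⟩ y → K (x ⊛ y)
  ⟨⟩-⊛-closed {K} {as} K-ideal gens {y = y} x∈ y∈ =
    ⟨⟩-least (⊛-preimage K-ideal y) generator-times-y x∈
    where
    generator-times-y : ∀ {a} → a ∈ as → K (a ⊛ y)
    generator-times-y {a} a∈ =
      subst K (⊛-comm y a) (⟨⟩-least (⊛-preimage K-ideal a) (λ {b} b∈ → subst K (⊛-comm a b) (gens a∈ b∈)) y∈)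

  ⊗-⊛∈ : ∀ {I J a b} → I a → J b → (I ⊗ J) (a ⊛ b)
  ⊗-⊛∈ {a = a} {b} a∈ b∈ = (a , b) ∷ [] , (a∈ , b∈) ∷ [] , sym (+-identityʳ (a ⊛ b))

  sumProd-++ : ∀ ps qs → sumProd (ps ++ qs) ≡ sumProd ps ⊕ sumProd qs
  sumProd-++ []             qs = sym (⊕-identityˡ (sumProd qs))
  sumProd-++ ((a , b) ∷ ps) qs =
    trans (cong ((a ⊛ b) ⊕_) (sumProd-++ ps qs)) (sym (⊕-assoc (a ⊛ b) (sumProd ps) (sumProd qs)))

  ⊗-isIdeal : ∀ {I J} → IsIdeal I → IsIdeal (I ⊗ J)
  ⊗-isIdeal {I} {J} I-ideal = record { 0∈ = [] , [] , refl ; ⊕∈ = ⊕∈⊗ ; ⊛∈ = ⊛∈⊗ }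
    where
    ⊕∈⊗ : ∀ {x y} → (I ⊗ J) x → (I ⊗ J) y → (I ⊗ J) (x ⊕ y)
    ⊕∈⊗ (ps , ps∈ , refl) (qs , qs∈ , refl) = ps ++ qs , ++⁺ ps∈ qs∈ , sym (sumProd-++ ps qs)

    ⊛∈⊗ : ∀ r {x} → (I ⊗ J) x → (I ⊗ J) (r ⊛ x)
    ⊛∈⊗ r ([] , [] , refl) = [] , [] , zeroʳ r
    ⊛∈⊗ r (((a , b) ∷ ps) , (a∈ , b∈) ∷ ps∈ , refl) =
      subst (I ⊗ J) (sym (scale r a b (sumProd ps)))
            (⊕∈⊗ (⊗-⊛∈ (⊛∈ I-ideal r a∈) b∈) (⊛∈⊗ r (ps , ps∈ , refl)))
      where
      scale : ∀ r a b s → r ⊛ ((a ⊛ b) ⊕ s) ≡ ((r ⊛ a) ⊛ b) ⊕ (r ⊛ s)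
      scale r a b s = trans (⊛-distribˡ r (a ⊛ b) s) (cong (_⊕ (r ⊛ s)) (sym (⊛-assoc r a b)))

  ⊗-least : ∀ {I J K} → IsIdeal K → (∀ {a b} → I a → J b → K (a ⊛ b)) → (I ⊗ J) ⊆ K
  ⊗-least K-ideal prods ([] , [] , refl) = 0∈ K-ideal
  ⊗-least K-ideal prods (((a , b) ∷ ps) , (a∈ , b∈) ∷ ps∈ , refl) =
    ⊕∈ K-ideal (prods a∈ b∈) (⊗-least K-ideal prods (ps , ps∈ , refl))

  conj : Elt → Elt
  conj (a + b τ) = a + (- b) τ

  norm-conj : ∀ x → x ⊛ conj x ≡ ι (re x * re x - im x * im x * D)
  norm-conj (a + b τ) = elt≡ (norm-re a b D) (norm-im a b)

  trace-conj : ∀ x → x ⊕ conj x ≡ ι (re x + re x)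
  trace-conj (a + b τ) = elt≡ refl (ℤ.+-inverseʳ b)

  ι-⊛ : ∀ a b → ι (a * b) ≡ ι a ⊛ ι b
  ι-⊛ a b = elt≡ (ι-⊛-re a b D) (ι-⊛-im a b)

  -- If c·U = g·h, then  g·(aU + b(g + h)²) = (ag + b(2g + h)c)·U + (bg)·g²:
  -- expanding b(g + h)², every term but b·g³ contains the factor g·h = c·U.
  factor-through-norm : ∀ a b g h c U → c ⊛ U ≡ g ⊛ h →
    g ⊛ ((a ⊛ U) ⊕ (b ⊛ ((g ⊕ h) ⊛ (g ⊕ h))))
      ≡ (((a ⊛ g) ⊕ ((b ⊛ ((g ⊕ g) ⊕ h)) ⊛ c)) ⊛ U) ⊕ ((b ⊛ g) ⊛ (g ⊛ g))
  factor-through-norm a b g h c U cU≡gh = begin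
    g ⊛ ((a ⊛ U) ⊕ (b ⊛ ((g ⊕ h) ⊛ (g ⊕ h))))
      ≡⟨ expand a b g h U ⟩
    (((a ⊛ g) ⊛ U) ⊕ (B ⊛ (g ⊛ h))) ⊕ ((b ⊛ g) ⊛ (g ⊛ g))
      ≡⟨ cong (λ z → (((a ⊛ g) ⊛ U) ⊕ (B ⊛ z)) ⊕ ((b ⊛ g) ⊛ (g ⊛ g))) (sym cU≡gh) ⟩
    (((a ⊛ g) ⊛ U) ⊕ (B ⊛ (c ⊛ U))) ⊕ ((b ⊛ g) ⊛ (g ⊛ g))
      ≡⟨ cong (λ z → (((a ⊛ g) ⊛ U) ⊕ z) ⊕ ((b ⊛ g) ⊛ (g ⊛ g))) (sym (⊛-assoc B c U)) ⟩
    (((a ⊛ g) ⊛ U) ⊕ ((B ⊛ c) ⊛ U)) ⊕ ((b ⊛ g) ⊛ (g ⊛ g))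
      ≡⟨ cong (_⊕ ((b ⊛ g) ⊛ (g ⊛ g))) (sym (distribʳ U (a ⊛ g) (B ⊛ c))) ⟩
    (((a ⊛ g) ⊕ (B ⊛ c)) ⊛ U) ⊕ ((b ⊛ g) ⊛ (g ⊛ g)) ∎
    where
    open ≡-Reasoning
    B : Elt
    B = b ⊛ ((g ⊕ g) ⊕ h)
    expand : ∀ a b g h U → g ⊛ ((a ⊛ U) ⊕ (b ⊛ ((g ⊕ h) ⊛ (g ⊕ h))))
                          ≡ (((a ⊛ g) ⊛ U) ⊕ ((b ⊛ ((g ⊕ g) ⊕ h)) ⊛ (g ⊛ h))) ⊕ ((b ⊛ g) ⊛ (g ⊛ g))
    expand = solve 5 (λ a b g h U →
      (g :* ((a :* U) :+ (b :* ((g :+ h) :* (g :+ h)))))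
        ⊜ ((((a :* g) :* U) :+ ((b :* ((g :+ g) :+ h)) :* (g :* h))) :+ ((b :* g) :* (g :* g)))) refl
      where open import Tactic.RingSolver.NonReflective almostCommutativeRing using (solve; _⊜_)
            open import Tactic.RingSolver.Core.Expression using () renaming (_⊕_ to _:+_; _⊗_ to _:*_)

Comaximal : ℤ → ℤ → Set
Comaximal p q = ∃₂ λ a b → a * p + b * q ≡ 1ℤ

comaximal-sym : ∀ {p q} → Comaximal p q → Comaximal q p
comaximal-sym {p} {q} (a , b , e) = b , a , trans (ℤ.+-comm (b * q) (a * p)) e

-- (ap + bq)(cp + dr) = 1 exhibits p and qr as comaximal.
comaximal-*ʳ : ∀ {p q r} → Comaximal p q → Comaximal p r → Comaximal p (q * r)
comaximal-*ʳ {p} {q} {r} (a , b , e₁) (c , d , e₂) =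
  a * c * p + a * d * r + b * q * c , b * d , trans (expand a b c d p q r) (cong₂ _*_ e₁ e₂)
  where
  expand : ∀ a b c d p q r → (a * c * p + a * d * r + b * q * c) * p + b * d * (q * r)
                            ≡ (a * p + b * q) * (c * p + d * r)
  expand = solve-∀

comaximal-*ˡ : ∀ {p q r} → Comaximal p r → Comaximal q r → Comaximal (p * q) r
comaximal-*ˡ c₁ c₂ = comaximal-sym (comaximal-*ʳ (comaximal-sym c₁) (comaximal-sym c₂))

comaximal-square : ∀ {p q} → Comaximal p q → Comaximal (p * p) (q * q)
comaximal-square c = comaximal-*ˡ (comaximal-*ʳ c c) (comaximal-*ʳ c c)

comaximal-1 : ∀ p → Comaximal p 1ℤ
comaximal-1 p = 0ℤ , 1ℤ , cong (_+ 1ℤ) (ℤ.*-zeroˡ p)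

comaximal-∣∣ : ∀ {p} q → Comaximal p (+ ∣ q ∣) → Comaximal p q
comaximal-∣∣     (+ n)      c           = c
comaximal-∣∣ {p} -[1+ n ] (a , b , e) = a , - b , trans (negate a b p -[1+ n ]) e
  where
  negate : ∀ a b p q → a * p + (- b) * q ≡ a * p + b * (- q)
  negate = solve-∀

bézout-cast : ∀ x y m n → 1 ℕ.+ y ℕ.* n ≡ x ℕ.* m → 1ℤ + + y * + n ≡ + x * + m
bézout-cast x y m n eq = begin
  1ℤ + + y * + n   ≡⟨ cong (λ z → 1ℤ + z) (ℤ.pos-* y n) ⟨
  1ℤ + + (y ℕ.* n) ≡⟨ ℤ.pos-+ 1 (y ℕ.* n) ⟨
  + (1 ℕ.+ y ℕ.* n) ≡⟨ cong +_ eq ⟩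
  + (x ℕ.* m)      ≡⟨ ℤ.pos-* x m ⟩
  + x * + m        ∎
  where open ≡-Reasoning

bézout-rearrange : ∀ X Y M N → 1ℤ + Y * N ≡ X * M → X * M + (- Y) * N ≡ 1ℤ
bézout-rearrange X Y M N h = trans (cong (_+ (- Y) * N) (sym h)) (cancel Y N)
  where
  cancel : ∀ Y N → 1ℤ + Y * N + (- Y) * N ≡ 1ℤ
  cancel = solve-∀

bézout⇒comaximal : ∀ {m n} → Bézout.Identity 1 m n → Comaximal (+ m) (+ n)
bézout⇒comaximal {m} {n} (Bézout.+- x y eq) = + x , - + y , bézout-rearrange (+ x) (+ y) (+ m) (+ n) (bézout-cast x y m n eq)
bézout⇒comaximal {m} {n} (Bézout.-+ x y eq) =
  comaximal-sym (+ y , - + x , bézout-rearrange (+ y) (+ x) (+ n) (+ m) (bézout-cast y x n m eq))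

coprime⇒comaximal : ∀ p q → Coprime ∣ p ∣ ∣ q ∣ → Comaximal p q
coprime⇒comaximal p q cop =
  comaximal-∣∣ q (comaximal-sym (comaximal-∣∣ p (comaximal-sym (bézout⇒comaximal (coprime-Bézout cop)))))

odd⇒coprime-2 : ∀ {m} → ¬ 2 ∣ℕ m → Coprime m 2
odd⇒coprime-2 odd {d} (d∣m , d∣2) with irreducible[2] d∣2
... | inj₁ d≡1 = d≡1
... | inj₂ refl = ⊥-elim (odd d∣m)

norm-g-value : ∀ u v f →
  ((+ 2) * v * f - 0ℤ) * ((+ 2) * v * f - 0ℤ)
    - (0ℤ - + 1) * (0ℤ - + 1) * (- ((+ 2) * (u * u - (+ 2) * (v * v)) * (f * f)))
  ≡ (+ 2) * (f * f) * (u * u)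
norm-g-value = solve-∀

trace-g-value : ∀ v f → ((+ 2) * v * f - 0ℤ) + ((+ 2) * v * f - 0ℤ) ≡ (+ 4) * v * f
trace-g-value = solve-∀

module Factorisation (u v f : ℤ) where
  D : ℤ
  D = - ((+ 2) * (u * u - (+ 2) * (v * v)) * (f * f))

  open QuadraticOrder D

  g : Elt
  g = ι ((+ 2) * v * f) ⊖ τ′

  c : Elt
  c = ι ((+ 2) * (f * f))

  w : ℤ
  w = (+ 4) * v * f

  𝔲 : Subset
  𝔲 = ⟨ ι u ∷ g ∷ [] ⟩

  𝔭 : Subset
  𝔭 = ⟨ g ∷ c ∷ [] ⟩

  norm-g : g ⊛ conj g ≡ c ⊛ (ι u ⊛ ι u)
  norm-g = begin
    g ⊛ conj g                         ≡⟨ norm-conj g ⟩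
    ι (re g * re g - im g * im g * D)  ≡⟨ cong ι (norm-g-value u v f) ⟩
    ι ((+ 2) * (f * f) * (u * u))      ≡⟨ ι-⊛ ((+ 2) * (f * f)) (u * u) ⟩
    c ⊛ ι (u * u)                      ≡⟨ cong (c ⊛_) (ι-⊛ u u) ⟩
    c ⊛ (ι u ⊛ ι u)                    ∎
    where open ≡-Reasoning

  trace-g : g ⊕ conj g ≡ ι w
  trace-g = trans (trace-conj g) (cong ι (trace-g-value v f))

  ⟨g⟩ : IsIdeal ⟨ g ∷ [] ⟩
  ⟨g⟩ = ⟨⟩-isIdeal (g ∷ [])

  𝔲²⊆ : (𝔲 ⊗ 𝔲) ⊆ ⟨ ι u ⊛ ι u ∷ g ∷ [] ⟩
  𝔲²⊆ = ⊗-least I (⟨⟩-⊛-closed I generators)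
    where
    I : IsIdeal ⟨ ι u ⊛ ι u ∷ g ∷ [] ⟩
    I = ⟨⟩-isIdeal (ι u ⊛ ι u ∷ g ∷ [])
    g∈ : ⟨ ι u ⊛ ι u ∷ g ∷ [] ⟩ g
    g∈ = ∈⟨⟩ (there (here refl))
    generators : ∀ {a b} → a ∈ (ι u ∷ g ∷ []) → b ∈ (ι u ∷ g ∷ []) → ⟨ ι u ⊛ ι u ∷ g ∷ [] ⟩ (a ⊛ b)
    generators (here refl)         (here refl)         = ∈⟨⟩ (here refl)
    generators (here refl)         (there (here refl)) = ⊛∈ I (ι u) g∈
    generators (there (here refl)) _                   = ⊛∈ʳ I _ g∈

  -- 𝔭𝔲² ⊆ (g): products of the generators g, c of 𝔭 with u², g are multiples
  -- of g, using c·u² = g·ḡ.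
  𝔭𝔲²⊆⟨g⟩ : (𝔭 ⊗ (𝔲 ⊗ 𝔲)) ⊆ ⟨ g ∷ [] ⟩
  𝔭𝔲²⊆⟨g⟩ = ⊗-least ⟨g⟩ (λ a∈ b∈ → ⟨⟩-⊛-closed ⟨g⟩ generators a∈ (𝔲²⊆ b∈))
    where
    g∈ : ⟨ g ∷ [] ⟩ g
    g∈ = ∈⟨⟩ (here refl)
    generators : ∀ {a b} → a ∈ (g ∷ c ∷ []) → b ∈ (ι u ⊛ ι u ∷ g ∷ []) → ⟨ g ∷ [] ⟩ (a ⊛ b)
    generators (here refl)         _                   = ⊛∈ʳ ⟨g⟩ _ g∈
    generators (there (here refl)) (here refl)         = subst ⟨ g ∷ [] ⟩ norm-g (⊛∈ʳ ⟨g⟩ (conj g) g∈)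
    generators (there (here refl)) (there (here refl)) = ⊛∈ ⟨g⟩ c g∈

  -- g ∈ 𝔭𝔲²: from a·u² + b·w² = 1 and w = g + ḡ,
  -- g = (a g + b(2g + ḡ)c)·u² + (b g)·g², with both coefficients in 𝔭.
  g∈𝔭𝔲² : Comaximal (u * u) (w * w) → (𝔭 ⊗ (𝔲 ⊗ 𝔲)) g
  g∈𝔭𝔲² (a , b , e) =
    subst (𝔭 ⊗ (𝔲 ⊗ 𝔲)) (sym decomposition)
      (⊕∈ 𝔭𝔲² (⊗-⊛∈ P₁∈𝔭 (⊗-⊛∈ u∈𝔲 u∈𝔲)) (⊗-⊛∈ P₂∈𝔭 (⊗-⊛∈ g∈𝔲 g∈𝔲)))
    where
    open ≡-Reasoning
    P : IsIdeal 𝔭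
    P = ⟨⟩-isIdeal (g ∷ c ∷ [])
    𝔭𝔲² : IsIdeal (𝔭 ⊗ (𝔲 ⊗ 𝔲))
    𝔭𝔲² = ⊗-isIdeal P
    u∈𝔲 : 𝔲 (ι u)
    u∈𝔲 = ∈⟨⟩ (here refl)
    g∈𝔲 : 𝔲 g
    g∈𝔲 = ∈⟨⟩ (there (here refl))
    P₁ P₂ : Elt
    P₁ = (ι a ⊛ g) ⊕ ((ι b ⊛ ((g ⊕ g) ⊕ conj g)) ⊛ c)
    P₂ = ι b ⊛ g
    P₁∈𝔭 : 𝔭 P₁
    P₁∈𝔭 = ⊕∈ P (⊛∈ P (ι a) (∈⟨⟩ (here refl)))
                 (⊛∈ P (ι b ⊛ ((g ⊕ g) ⊕ conj g)) (∈⟨⟩ (there (here refl))))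
    P₂∈𝔭 : 𝔭 P₂
    P₂∈𝔭 = ⊛∈ P (ι b) (∈⟨⟩ (here refl))
    unit : 1e ≡ (ι a ⊛ (ι u ⊛ ι u)) ⊕ (ι b ⊛ ((g ⊕ conj g) ⊛ (g ⊕ conj g)))
    unit = begin
      1e                                                 ≡⟨ cong ι (sym e) ⟩
      ι (a * (u * u)) ⊕ ι (b * (w * w))                  ≡⟨ cong₂ _⊕_ (ι-⊛ a _) (ι-⊛ b _) ⟩
      (ι a ⊛ ι (u * u)) ⊕ (ι b ⊛ ι (w * w))              ≡⟨ cong₂ (λ x y → (ι a ⊛ x) ⊕ (ι b ⊛ y)) (ι-⊛ u u) (ι-⊛ w w) ⟩
      (ι a ⊛ (ι u ⊛ ι u)) ⊕ (ι b ⊛ (ι w ⊛ ι w))          ≡⟨ cong (λ x → (ι a ⊛ (ι u ⊛ ι u)) ⊕ (ι b ⊛ (x ⊛ x))) (sym trace-g) ⟩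
      (ι a ⊛ (ι u ⊛ ι u)) ⊕ (ι b ⊛ ((g ⊕ conj g) ⊛ (g ⊕ conj g))) ∎
    decomposition : g ≡ (P₁ ⊛ (ι u ⊛ ι u)) ⊕ (P₂ ⊛ (g ⊛ g))
    decomposition = begin
      g        ≡⟨ *-identityʳ g ⟨
      g ⊛ 1e   ≡⟨ cong (g ⊛_) unit ⟩
      _        ≡⟨ factor-through-norm (ι a) (ι b) g (conj g) c (ι u ⊛ ι u) (sym norm-g) ⟩
      _        ∎

  ⟨g⟩⊆𝔭𝔲² : Comaximal (u * u) (w * w) → ⟨ g ∷ [] ⟩ ⊆ (𝔭 ⊗ (𝔲 ⊗ 𝔲))
  ⟨g⟩⊆𝔭𝔲² comaximal = ⟨⟩-least (⊗-isIdeal (⟨⟩-isIdeal (g ∷ c ∷ [])))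
                                 (λ { (here refl) → g∈𝔭𝔲² comaximal })

-- u is odd and prime to v, hence prime to w = 4vf; so u² and w² are comaximal.
u²-w²-comaximal : ∀ u v f → Coprime ∣ u ∣ ∣ v ∣ → ¬ ((+ 2) ∣ℤ u) → (f ≡ + 1 ⊎ f ≡ + 4) →
                  Comaximal (u * u) (Factorisation.w u v f * Factorisation.w u v f)
u²-w²-comaximal u v f u⊥v odd f∈ =
  comaximal-square (comaximal-*ʳ (comaximal-*ʳ (comaximal-*ʳ u⊥2 u⊥2) (coprime⇒comaximal u v u⊥v)) (u⊥f f∈))
  where
  u⊥2 : Comaximal u (+ 2)
  u⊥2 = coprime⇒comaximal u (+ 2) (odd⇒coprime-2 odd)
  u⊥f : ∀ {f} → f ≡ + 1 ⊎ f ≡ + 4 → Comaximal u f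
  u⊥f (inj₁ refl) = comaximal-1 u
  u⊥f (inj₂ refl) = comaximal-*ʳ u⊥2 u⊥2

-- The theorem: (2vf − τ) = 𝔭_f 𝔲².
lemma10 : (u v f : ℤ) → Coprime ∣ u ∣ ∣ v ∣ → u > 0ℤ → ¬ ((+ 2) ∣ℤ u) → (u * u - (+ 2) * (v * v)) > 0ℤ → (f ≡ + 1 ⊎ f ≡ + 4) →
    let D = - ((+ 2) * (u * u - (+ 2) * (v * v)) * (f * f))
        open Order D
        g = ι ((+ 2) * v * f) ⊖ τ′
        𝔲 = ⟨ ι u ∷ g ∷ [] ⟩
        𝔭 = ⟨ g ∷ ι ((+ 2) * (f * f)) ∷ [] ⟩
    in ⟨ g ∷ [] ⟩ ≐ (𝔭 ⊗ (𝔲 ⊗ 𝔲))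
lemma10 u v f u⊥v _ odd _ f∈ x =
  ⟨g⟩⊆𝔭𝔲² (u²-w²-comaximal u v f u⊥v odd f∈) , 𝔭𝔲²⊆⟨g⟩
  where open Factorisation u v f
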